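{- Let $s$ be a string and $\mathcal{A}[0..N-1]$ its suffix array. If an index $k$ satisfies $\mathcal{A}[k]>\mathcal{A}[k']$ for all $0\le k'<k$ (i.e. $\mathcal{A}[k]$ is the maximum of the range $\mathcal{A}[0..k]$), then the suffix of $s$ starting at position $\mathcal{A}[k]$ is a Lyndon word.
   Context: Strings are compared lexicographically (a proper prefix is smaller). The suffix array $\mathcal{A}$ of $s$ lists the starting positions of all nonempty suffixes of $s$ so that $\mathcal{A}[0]$ is the start of the lexicographically smallest suffix, $\mathcal{A}[1]$ the next, and so on. A Lyndon word is a nonempty string strictly lexicographically smaller than each of its nonempty proper suffixes. -}

module Defs where

open import Level using (Level)
open import Data.Nat using (ℕ; zero; suc; _<_)
open import Data.Fin using (Fin; toℕ)
open import Data.List using (List; []; _∷_; length; drop)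
open import Data.Product using (_×_; Σ)
open import Relation.Binary.PropositionalEquality using (_≡_)
open import Relation.Binary.Bundles using (StrictTotalOrder)

module _ {a ℓ₁ ℓ₂ : Level} (O : StrictTotalOrder a ℓ₁ ℓ₂) where
  open StrictTotalOrder O renaming (Carrier to Σc; _<_ to _≺_)

  data _<lex_ : List Σc → List Σc → Set (Level._⊔_ a (Level._⊔_ ℓ₁ ℓ₂)) where
    []<∷ : ∀ {y ys} → [] <lex (y ∷ ys)
    head< : ∀ {x y xs ys} → x ≺ y → (x ∷ xs) <lex (y ∷ ys)
    tail< : ∀ {x y xs ys} → x ≈ y → xs <lex ys → (x ∷ xs) <lex (y ∷ ys)

  suffix : List Σc → ℕ → List Σc
  suffix s i = drop i s

  -- nonempty proper suffixes are suffix w j for 0 < j < |w|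
  IsLyndon : List Σc → Set (Level._⊔_ a (Level._⊔_ ℓ₁ ℓ₂))
  IsLyndon w = (0 < length w) × (∀ j → 0 < j → j < length w → w <lex suffix w j)

  -- A : Fin N → Fin N (N = |s|) is the suffix array of s: a permutation of
  -- the positions listing suffixes in increasing lexicographic order.
  record IsSuffixArray (s : List Σc) (A : Fin (length s) → Fin (length s))
         : Set (Level._⊔_ a (Level._⊔_ ℓ₁ ℓ₂)) where
    field
      surjective : ∀ p → Σ (Fin (length s)) λ k → A k ≡ p
      sorted : ∀ (k k′ : Fin (length s)) → toℕ k < toℕ k′ →
               suffix s (toℕ (A k)) <lex suffix s (toℕ (A k′))

module Submission where

-- Let p = A[k] be a prefix maximum of the suffix array.  Every
-- position q > p has a rank k″ (A is onto), and that rank cannot be ≤ k: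
-- k″ = k would force q = p, and k″ < k would force q < p by maximality.
-- So k < k″, and sortedness gives  suffix s p <lex suffix s q.  A suffix
-- that is smaller than every later suffix of s is a Lyndon word, because
-- its own proper suffixes are exactly the later suffixes of s.

open import Defs
open import Level using (Level)
open import Data.Nat using (ℕ; _<_; _+_; _∸_)
open import Data.Nat.Properties
  using (<-cmp; <-irrefl; <-asym; m<n⇒0<n∸m; m+[n∸m]≡n; <⇒≤;
         +-monoʳ-<; +-comm)
open import Data.Fin using (Fin; toℕ; fromℕ<)
open import Data.Fin.Properties using (toℕ<n; toℕ-injective; toℕ-fromℕ<)
open import Data.List using (List; length; drop)
open import Data.List.Properties using (length-drop; drop-drop)
open import Data.Product using (Σ; _,_)
open import Data.Empty using (⊥-elim)
open import Relation.Binary.Definitions using (tri<; tri≈; tri>)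
open import Relation.Binary.PropositionalEquality
  using (_≡_; refl; sym; trans; cong; subst)
open import Relation.Binary.Bundles using (StrictTotalOrder)

after-prefix-maximum : ∀ {n} (f : Fin n → ℕ) (k : Fin n) →
  (∀ k′ → toℕ k′ < toℕ k → f k′ < f k) →
  ∀ k″ → f k < f k″ → toℕ k < toℕ k″
after-prefix-maximum f k isMax k″ fk<fk″ with <-cmp (toℕ k) (toℕ k″)
... | tri< k<k″ _ _ = k<k″
... | tri≈ _ k≡k″ _ =
  ⊥-elim (<-irrefl (cong f (toℕ-injective k≡k″)) fk<fk″)
... | tri> _ _ k″<k = ⊥-elim (<-asym fk<fk″ (isMax k″ k″<k))

module _ {a ℓ₁ ℓ₂ : Level} (O : StrictTotalOrder a ℓ₁ ℓ₂) where
  open StrictTotalOrder O using () renaming (Carrier to Σc)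

  _<ˡ_ : List Σc → List Σc → Set (a Level.⊔ ℓ₁ Level.⊔ ℓ₂)
  _<ˡ_ = _<lex_ O

  suffix-suffix : ∀ (s : List Σc) p j →
    suffix O (suffix O s p) j ≡ suffix O s (p + j)
  suffix-suffix s p j = drop-drop p j s

  -- A suffix of s that is lexicographically smaller than every later
  -- nonempty suffix of s is a Lyndon word: its proper suffixes are those
  -- later suffixes.
  lyndon-if-below-later-suffixes : ∀ (s : List Σc) p → p < length s →
    (∀ q → p < q → q < length s → suffix O s p <ˡ suffix O s q) →
    IsLyndon O (suffix O s p)
  lyndon-if-below-later-suffixes s p p<n below = nonempty , belowProper
    where
    len : length (suffix O s p) ≡ length s ∸ p
    len = length-drop p s

    nonempty : 0 < length (suffix O s p)
    nonempty = subst (0 <_) (sym len) (m<n⇒0<n∸m p<n)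

    belowProper : ∀ j → 0 < j → j < length (suffix O s p) →
      suffix O s p <ˡ suffix O (suffix O s p) j
    belowProper j 0<j j<len =
      subst (suffix O s p <ˡ_) (sym (suffix-suffix s p j))
            (below (p + j) p<p+j p+j<n)
      where
      p<p+j : p < p + j
      p<p+j = subst (_< p + j) (+-comm p 0) (+-monoʳ-< p 0<j)

      p+j<n : p + j < length s
      p+j<n = subst (p + j <_) (m+[n∸m]≡n (<⇒≤ p<n))
                (+-monoʳ-< p (subst (j <_) len j<len))

  module _ {s : List Σc} {A : Fin (length s) → Fin (length s)}
           (SA : IsSuffixArray O s A) where
    open IsSuffixArray SA

    rank-of : ∀ q → q < length s → Σ (Fin (length s)) λ k″ → toℕ (A k″) ≡ q
    rank-of q q<n with surjective (fromℕ< q<n)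
    ... | k″ , Ak″≡q = k″ , trans (cong toℕ Ak″≡q) (toℕ-fromℕ< q<n)

    -- If A[k] is the maximum of A[0..k], the suffix at A[k] is smaller than
    -- every later suffix: a later position has a larger rank.
    prefix-maximum-below-later : ∀ k →
      (∀ k′ → toℕ k′ < toℕ k → toℕ (A k′) < toℕ (A k)) →
      ∀ q → toℕ (A k) < q → q < length s →
      suffix O s (toℕ (A k)) <ˡ suffix O s q
    prefix-maximum-below-later k isMax q p<q q<n with rank-of q q<n
    ... | k″ , refl =
      sorted k k″ (after-prefix-maximum (λ i → toℕ (A i)) k isMax k″ p<q)

lemma9 : ∀ {a ℓ₁ ℓ₂ : Level} (O : StrictTotalOrder a ℓ₁ ℓ₂)
    (s : List (StrictTotalOrder.Carrier O))
    (A : Fin (length s) → Fin (length s)) →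
    IsSuffixArray O s A →
    (k : Fin (length s)) →
    (∀ (k′ : Fin (length s)) → toℕ k′ < toℕ k → toℕ (A k′) < toℕ (A k)) →
    IsLyndon O (suffix O s (toℕ (A k)))
lemma9 O s A SA k isMax =
  lyndon-if-below-later-suffixes O s (toℕ (A k)) (toℕ<n (A k))
    (prefix-maximum-below-later O SA k isMax)
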